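{- Let $k\ge 3$ and $D\ge 2$. Let $G'$ be a $k$-colored layered connected graph of order $n$, diameter $D$ and minimum degree at least $\delta$, with layers $L'_0,\ldots,L'_D$, and let $c'(i)$ denote the number of colors used on $L'_i$. Then there is a $k$-colored layered connected graph $G$ of the same order $n$, diameter $D$ and minimum degree at least $\delta$, with layers $L_0,\ldots,L_D$ and with $c(i)$ denoting the number of colors used on $L_i$, such that $c(0)=c(D)=1$, and for each $i$ with $0\le i\le D-2$ we have $c'(i)=c(i)$ and $L'_i=L_i$.
   Context: A graph is $k$-colored if a fixed proper vertex coloring with at most $k$ colors is given. A connected graph is layered if a vertex $x$ whose eccentricity equals the diameter $D$ of the graph is fixed, together with the distance layers $L_0=\{x\},L_1,\ldots,L_D$, where $L_i$ is the set of vertices at distance exactly $i$ from $x$. For a layer $L_i$, the number of colors used on $L_i$ is the number of distinct colors of the fixed coloring appearing on vertices of $L_i$. -}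

module Defs where

open import Data.Nat using (ℕ; zero; suc; _≤_; _∸_)
open import Data.Bool using (Bool; true; false; _∧_; _∨_; not)
open import Data.Fin using (Fin; _≟_)
open import Data.Fin.Subset using (Subset; ∣_∣)
open import Data.Vec using (tabulate)
open import Data.List using (allFin)
open import Data.Bool.ListAction using (any)
open import Data.Product using (Σ; _×_; ∃)
open import Relation.Binary.PropositionalEquality using (_≡_; _≢_)
open import Relation.Nullary.Decidable using (⌊_⌋)

record Graph (n : ℕ) : Set where
  field
    adj   : Fin n → Fin n → Bool
    sym   : ∀ u v → adj u v ≡ adj v u
    loopless : ∀ v → adj v v ≡ false
open Graph public

record Coloring {n : ℕ} (G : Graph n) (k : ℕ) : Set where
  field
    col    : Fin n → Fin k
    proper : ∀ u v → adj G u v ≡ true → col u ≢ col v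
open Coloring public

-- inBall G x i v = true  iff  there is a walk of length ≤ i from x to v,
-- i.e. dist(x,v) ≤ i.
inBall : {n : ℕ} → Graph n → Fin n → ℕ → Fin n → Bool
inBall G x zero    v = ⌊ x ≟ v ⌋
inBall {n} G x (suc i) v =
  inBall G x i v ∨ any (λ u → inBall G x i u ∧ adj G u v) (allFin n)

inLayer : {n : ℕ} → Graph n → Fin n → ℕ → Fin n → Bool
inLayer G x zero    v = inBall G x zero v
inLayer G x (suc i) v = inBall G x (suc i) v ∧ not (inBall G x i v)

-- Connected with diameter exactly D (D ≥ 1): every pair is at distance ≤ D,
-- and some pair is at distance > D - 1.
HasDiameter : {n : ℕ} → Graph n → ℕ → Set
HasDiameter {n} G D =
  (∀ u v → inBall G u D v ≡ true) ×
  Σ (Fin n) (λ u → Σ (Fin n) (λ v → inBall G u (D ∸ 1) v ≡ false))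

HasEccentricity : {n : ℕ} → Graph n → Fin n → ℕ → Set
HasEccentricity {n} G x D =
  (∀ v → inBall G x D v ≡ true) × Σ (Fin n) (λ v → inBall G x (D ∸ 1) v ≡ false)

degree : {n : ℕ} → Graph n → Fin n → ℕ
degree G v = ∣ tabulate (adj G v) ∣

MinDegreeAtLeast : {n : ℕ} → Graph n → ℕ → Set
MinDegreeAtLeast G δ = ∀ v → δ ≤ degree G v

numColors : {n k : ℕ} (G : Graph n) → Coloring G k → Fin n → ℕ → ℕ
numColors {n} G c x i =
  ∣ tabulate (λ a → any (λ v → inLayer G x i v ∧ ⌊ col c v ≟ a ⌋) (allFin n)) ∣

IsLayered : {n k : ℕ} (G : Graph n) → Coloring G k → Fin n → ℕ → Set
IsLayered G c x D = HasDiameter G D × HasEccentricity G x D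

-- Join a vertex u of L_{D-2} to every vertex of L_D whose colour differs from a target colour t.
-- Those vertices drop into L_{D-1}, while L_0,…,L_{D-2} are untouched because u is already at
-- distance D-2, and L_D becomes monochromatic. Adding edges keeps every distance ≤ D and every
-- degree ≥ δ, and a vertex of colour t stays in L_D, so the diameter and the eccentricity of x
-- are still D. The new edges are properly coloured as long as no colour of L_D other than t is
-- the colour a of u: take t = a if a occurs on L_D, and any colour of L_D otherwise.
module Submission where

open import Defs hiding (sym)
open import Data.Nat using (ℕ; zero; suc; _≤_; _<_; _∸_; z≤n; s≤s)
open import Data.Nat.Properties using (≤-refl; ≤-trans; <⇒≤; ≤⇒≤′)
open import Data.Nat.Base using (_≤′_; ≤′-refl; ≤′-step)
open import Data.Bool using (Bool; true; false; _∧_; _∨_; not; T) renaming (_≟_ to _≟ᵇ_)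
open import Data.Bool.Properties using (∨-comm; ∨-zeroʳ; ∨-identityʳ; ∧-zeroʳ; ∧-conicalˡ; ∧-conicalʳ; ∨-conicalˡ; ∨-conicalʳ; T-≡)
open import Data.Bool.ListAction using (any; or)
open import Data.Fin using (Fin; _≟_)
open import Data.Fin.Properties using (any?)
open import Data.Fin.Subset using (Subset; _∈_; _⊆_; ∣_∣; ⁅_⁆)
open import Data.Fin.Subset.Properties using (⊆-antisym; p⊆q⇒∣p∣≤∣q∣; ∣⁅x⁆∣≡1; x∈⁅x⁆; x∈⁅y⁆⇒x≡y)
open import Data.List using (allFin)
open import Data.List.Properties using (map-cong)
open import Data.List.Relation.Unary.Any using (satisfied)
open import Data.List.Relation.Unary.Any.Properties using (any⁺; any⁻)
open import Data.List.Membership.Propositional using (lose)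
open import Data.List.Membership.Propositional.Properties using (∈-allFin)
open import Data.Vec using (tabulate)
open import Data.Vec.Properties using (tabulate-cong; lookup∘tabulate; []=⇒lookup; lookup⇒[]=)
open import Data.Product using (Σ; ∃; _×_; _,_)
open import Data.Sum using (_⊎_; inj₁; inj₂)
open import Function using (Equivalence; _∘_)
open import Relation.Nullary using (yes; no; _×-dec_; contradiction)
open import Relation.Nullary.Decidable using (⌊_⌋; fromWitness; fromWitnessFalse; toWitness; toWitnessFalse)
open import Relation.Binary.PropositionalEquality using (_≡_; _≢_; refl; sym; trans; cong; cong₂; subst; _≗_)

open Equivalence using (to; from)

private variable
  n k : ℕ

∨-true⁻ : ∀ {a b} → a ∨ b ≡ true → a ≡ true ⊎ b ≡ true
∨-true⁻ {true}  _ = inj₁ refl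
∨-true⁻ {false} h = inj₂ h

∨-true⁺ˡ : ∀ {a} b → a ≡ true → a ∨ b ≡ true
∨-true⁺ˡ b refl = refl

∨-true⁺ʳ : ∀ a {b} → b ≡ true → a ∨ b ≡ true
∨-true⁺ʳ a refl = ∨-zeroʳ a

not-true : ∀ {a} → not a ≡ true → a ≡ false
not-true {false} _ = refl

not-false : ∀ {a} → not a ≡ false → a ≡ true
not-false {true} _ = refl

true≢false : ∀ {a} → a ≡ true → a ≢ false
true≢false refl ()

≡-by-truth : ∀ {a b} → (a ≡ true → b ≡ true) → (b ≡ true → a ≡ true) → a ≡ b
≡-by-truth {false} {false} _ _ = refl
≡-by-truth {false} {true}  _ b⇒a = b⇒a refl
≡-by-truth {true}          a⇒b _ = sym (a⇒b refl)

≟-true : {a b : Fin n} → ⌊ a ≟ b ⌋ ≡ true → a ≡ b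
≟-true {a = a} {b} h = toWitness {a? = a ≟ b} (from T-≡ h)

≟-false : {a b : Fin n} → ⌊ a ≟ b ⌋ ≡ false → a ≢ b
≟-false {a = a} {b} h = toWitnessFalse {a? = a ≟ b} (from T-≡ (cong not h))

≢⇒≟-false : {a b : Fin n} → a ≢ b → ⌊ a ≟ b ⌋ ≡ false
≢⇒≟-false {a = a} {b} a≢b = not-true (to T-≡ (fromWitnessFalse {a? = a ≟ b} a≢b))

≟-refl : (a : Fin n) → ⌊ a ≟ a ⌋ ≡ true
≟-refl a = to T-≡ (fromWitness {a? = a ≟ a} refl)

any-allFin⁺ : ∀ {n} (f : Fin n → Bool) (u : Fin n) → f u ≡ true → any f (allFin n) ≡ true
any-allFin⁺ f u fu = to T-≡ (any⁺ f (lose {P = T ∘ f} (∈-allFin u) (from T-≡ fu)))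

any-allFin⁻ : ∀ {n} (f : Fin n → Bool) → any f (allFin n) ≡ true → ∃ λ u → f u ≡ true
any-allFin⁻ {n} f h with u , fu ← satisfied (any⁻ f (allFin n) (from T-≡ h)) = u , to T-≡ fu

any-allFin-cong : ∀ {n} {f g : Fin n → Bool} → f ≗ g → any f (allFin n) ≡ any g (allFin n)
any-allFin-cong {n} f≗g = cong or (map-cong f≗g (allFin n))

module _ (G : Graph n) (x : Fin n) where

  inBall-suc : ∀ i {v} → inBall G x i v ≡ true → inBall G x (suc i) v ≡ true
  inBall-suc i = ∨-true⁺ˡ _

  inBall-mono : ∀ {i j v} → i ≤ j → inBall G x i v ≡ true → inBall G x j v ≡ true
  inBall-mono i≤j = go (≤⇒≤′ i≤j)
    where
    go : ∀ {i j v} → i ≤′ j → inBall G x i v ≡ true → inBall G x j v ≡ true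
    go ≤′-refl            h = h
    go (≤′-step {j} i≤j) h = inBall-suc j (go i≤j h)

  inBall-step : ∀ i {u v} → inBall G x i u ≡ true → adj G u v ≡ true → inBall G x (suc i) v ≡ true
  inBall-step i {u} {v} u∈ uv =
    ∨-true⁺ʳ (inBall G x i v) (any-allFin⁺ _ u (cong₂ _∧_ u∈ uv))

  inBall-suc⁻ : ∀ i {v} → inBall G x (suc i) v ≡ true →
                inBall G x i v ≡ true ⊎ ∃ λ u → inBall G x i u ≡ true × adj G u v ≡ true
  inBall-suc⁻ i h with ∨-true⁻ h
  ... | inj₁ v∈ = inj₁ v∈
  ... | inj₂ h′ with u , uv ← any-allFin⁻ _ h′ = inj₂ (u , ∧-conicalˡ _ _ uv , ∧-conicalʳ _ _ uv)

  layer-predecessor : ∀ i {v} → inBall G x (suc i) v ≡ true → inBall G x i v ≡ false →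
                      ∃ λ u → inBall G x i u ≡ true × (∀ j → j < i → inBall G x j u ≡ false)
                            × adj G u v ≡ true
  layer-predecessor i h v∉ with inBall-suc⁻ i h
  ... | inj₁ v∈ = contradiction v∉ (true≢false v∈)
  ... | inj₂ (u , u∈ , uv) = u , u∈ , u∉ , uv
    where
    u∉ : ∀ j → j < i → inBall G x j u ≡ false
    u∉ j j<i with inBall G x j u in u∈j
    ... | false = refl
    ... | true  = contradiction v∉ (true≢false (inBall-mono j<i (inBall-step j u∈j uv)))

_⊆ᴱ_ : Graph n → Graph n → Set
G ⊆ᴱ H = ∀ u v → adj G u v ≡ true → adj H u v ≡ true

inBall-⊆ᴱ : {G H : Graph n} → G ⊆ᴱ H → ∀ x i v → inBall G x i v ≡ true → inBall H x i v ≡ true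
inBall-⊆ᴱ G⊆H x zero v h = h
inBall-⊆ᴱ {G = G} {H} G⊆H x (suc i) v h with inBall-suc⁻ G x i h
... | inj₁ v∈ = inBall-suc H x i (inBall-⊆ᴱ G⊆H x i v v∈)
... | inj₂ (u , u∈ , uv) = inBall-step H x i (inBall-⊆ᴱ G⊆H x i u u∈) (G⊆H u v uv)

∈-tabulate⁺ : ∀ {f : Fin n → Bool} {a} → f a ≡ true → a ∈ tabulate f
∈-tabulate⁺ {f = f} {a} h = lookup⇒[]= a (tabulate f) (trans (lookup∘tabulate f a) h)

∈-tabulate⁻ : ∀ {f : Fin n → Bool} {a} → a ∈ tabulate f → f a ≡ true
∈-tabulate⁻ {f = f} {a} h = trans (sym (lookup∘tabulate f a)) ([]=⇒lookup h)

degree-⊆ᴱ : {G H : Graph n} → G ⊆ᴱ H → ∀ v → degree G v ≤ degree H v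
degree-⊆ᴱ G⊆H v = p⊆q⇒∣p∣≤∣q∣ λ {u} u∈ → ∈-tabulate⁺ (G⊆H v u (∈-tabulate⁻ u∈))

minDegree-⊆ᴱ : ∀ {δ} {G H : Graph n} → G ⊆ᴱ H → MinDegreeAtLeast G δ → MinDegreeAtLeast H δ
minDegree-⊆ᴱ {G = G} {H} G⊆H min v = ≤-trans (min v) (degree-⊆ᴱ {G = G} {H} G⊆H v)

inBall-cong : (G H : Graph n) (x : Fin n) (r : ℕ) →
              (∀ j u v → j < r → inBall G x j u ≡ true → adj G u v ≡ adj H u v) →
              ∀ i → i ≤ r → inBall G x i ≗ inBall H x i
inBall-cong G H x r agree zero    _   v = refl
inBall-cong {n} G H x r agree (suc i) i<r v =
  cong₂ _∨_ (ball-i v) (any-allFin-cong step)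
  where
  ball-i : inBall G x i ≗ inBall H x i
  ball-i = inBall-cong G H x r agree i (<⇒≤ i<r)
  step : ∀ u → inBall G x i u ∧ adj G u v ≡ inBall H x i u ∧ adj H u v
  step u rewrite sym (ball-i u) with inBall G x i u in u∈
  ... | false = refl
  ... | true  = agree i u v i<r u∈

inLayer-cong : (G H : Graph n) (x : Fin n) (r : ℕ) →
               (∀ i → i ≤ r → inBall G x i ≗ inBall H x i) →
               ∀ i → i ≤ r → inLayer G x i ≗ inLayer H x i
inLayer-cong G H x r balls zero    _   v = balls zero z≤n v
inLayer-cong G H x r balls (suc i) i<r v =
  cong₂ (λ a b → a ∧ not b) (balls (suc i) i<r v) (balls i (<⇒≤ i<r) v)

colorsOn : (Fin n → Bool) → (Fin n → Fin k) → Subset k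
colorsOn {n} L f = tabulate λ a → any (λ v → L v ∧ ⌊ f v ≟ a ⌋) (allFin n)

colorsOn-cong : {L L′ : Fin n → Bool} {f f′ : Fin n → Fin k} →
                L ≗ L′ → f ≗ f′ → colorsOn L f ≡ colorsOn L′ f′
colorsOn-cong L≗L′ f≗f′ = tabulate-cong λ a →
  any-allFin-cong λ v → cong₂ (λ b c → b ∧ ⌊ c ≟ a ⌋) (L≗L′ v) (f≗f′ v)

colorsOn-monochromatic : {L : Fin n → Bool} {f : Fin n → Fin k} (w : Fin n) → L w ≡ true →
                         (∀ v → L v ≡ true → f v ≡ f w) → colorsOn L f ≡ ⁅ f w ⁆
colorsOn-monochromatic {L = L} {f} w Lw mono = ⊆-antisym ⊆⁅fw⁆ ⁅fw⁆⊆
  where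
  ⊆⁅fw⁆ : colorsOn L f ⊆ ⁅ f w ⁆
  ⊆⁅fw⁆ {a} a∈ with v , hv ← any-allFin⁻ _ (∈-tabulate⁻ {a = a} a∈) =
    subst (_∈ ⁅ f w ⁆) (trans (sym (mono v (∧-conicalˡ _ _ hv))) (≟-true (∧-conicalʳ _ _ hv))) (x∈⁅x⁆ (f w))
  ⁅fw⁆⊆ : ⁅ f w ⁆ ⊆ colorsOn L f
  ⁅fw⁆⊆ a∈ with refl ← x∈⁅y⁆⇒x≡y (f w) a∈ = ∈-tabulate⁺ (any-allFin⁺ _ w (cong₂ _∧_ Lw (≟-refl (f w))))

numColors-root : (G : Graph n) (c : Coloring G k) (x : Fin n) → numColors G c x 0 ≡ 1
numColors-root G c x = trans (cong ∣_∣ (colorsOn-monochromatic x (≟-refl x) same)) (∣⁅x⁆∣≡1 (col c x))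
  where
  same : ∀ v → ⌊ x ≟ v ⌋ ≡ true → col c v ≡ col c x
  same v x≡v = cong (col c) (sym (≟-true x≡v))

numColors-cong : (G H : Graph n) (c : Coloring G k) (d : Coloring H k) (x : Fin n) (i : ℕ) →
                 inLayer G x i ≗ inLayer H x i → col c ≗ col d → numColors G c x i ≡ numColors H d x i
numColors-cong G H c d x i same-layer same-col = cong ∣_∣ (colorsOn-cong same-layer same-col)

pivot-colour : (L : Fin n → Bool) (f : Fin n → Fin k) (a : Fin k) (z : Fin n) → L z ≡ true →
               ∃ λ w → L w ≡ true × (∀ v → L v ≡ true → f v ≢ f w → f v ≢ a)
pivot-colour L f a z Lz with any? (λ w → (L w ≟ᵇ true) ×-dec (f w ≟ a))
... | yes (w , Lw , fw≡a) = w , Lw , λ v _ fv≢fw fv≡a → fv≢fw (trans fv≡a (sym fw≡a))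
... | no ∄                = z , Lz , λ v Lv _ fv≡a → ∄ (v , Lv , fv≡a)

module Star (G : Graph n) (centre : Fin n) (E : Fin n → Bool) (E-centre : E centre ≡ false) where

  starEdge : Fin n → Fin n → Bool
  starEdge u v = (⌊ u ≟ centre ⌋ ∧ E v) ∨ (⌊ v ≟ centre ⌋ ∧ E u)

  G⁺ : Graph n
  G⁺ = record
    { adj      = λ u v → adj G u v ∨ starEdge u v
    ; sym      = λ u v → cong₂ _∨_ (Graph.sym G u v) (∨-comm (⌊ u ≟ centre ⌋ ∧ E v) _)
    ; loopless = λ v → cong₂ _∨_ (loopless G v) (no-star-loop v)
    }
    where
    no-star-loop : ∀ v → starEdge v v ≡ false
    no-star-loop v with v ≟ centre
    ... | yes refl = cong₂ _∨_ E-centre E-centre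
    ... | no _     = refl

  G⊆G⁺ : G ⊆ᴱ G⁺
  G⊆G⁺ u v uv = ∨-true⁺ˡ (starEdge u v) uv

  starEdge-centre : ∀ {v} → E v ≡ true → adj G⁺ centre v ≡ true
  starEdge-centre {v} Ev = ∨-true⁺ʳ (adj G centre v) (∨-true⁺ˡ _ (cong₂ _∧_ (≟-refl centre) Ev))

  starEdge-inv : ∀ u v → starEdge u v ≡ true → (u ≡ centre × E v ≡ true) ⊎ (v ≡ centre × E u ≡ true)
  starEdge-inv u v h with ∨-true⁻ h
  ... | inj₁ h′ = inj₁ (≟-true (∧-conicalˡ _ _ h′) , ∧-conicalʳ _ _ h′)
  ... | inj₂ h′ = inj₂ (≟-true (∧-conicalˡ _ _ h′) , ∧-conicalʳ _ _ h′)

  starEdge-away : ∀ {u} v → u ≢ centre → E u ≡ false → starEdge u v ≡ false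
  starEdge-away {u} v u≢centre Eu
    rewrite ≢⇒≟-false u≢centre | Eu = ∧-zeroʳ ⌊ v ≟ centre ⌋

  coloring⁺ : (c : Coloring G k) → (∀ w → E w ≡ true → col c centre ≢ col c w) → Coloring G⁺ k
  coloring⁺ c E-avoids = record { col = col c ; proper = proper⁺ }
    where
    proper⁺ : ∀ u v → adj G⁺ u v ≡ true → col c u ≢ col c v
    proper⁺ u v h with ∨-true⁻ h
    ... | inj₁ uv = proper c u v uv
    ... | inj₂ s with starEdge-inv u v s
    ... | inj₁ (refl , Ev) = E-avoids v Ev
    ... | inj₂ (refl , Eu) = λ cu≡cv → E-avoids u Eu (sym cu≡cv)

  module _ (x : Fin n) (m : ℕ)
           (centre∈ : inBall G x m centre ≡ true)
           (centre∉ : ∀ j → j < m → inBall G x j centre ≡ false)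
           (E∉ : ∀ w → E w ≡ true → inBall G x m w ≡ false) where

    E-outside : ∀ j {u} → j ≤ m → inBall G x j u ≡ true → E u ≡ false
    E-outside j {u} j≤m u∈ with E u in Eu
    ... | false = refl
    ... | true  = contradiction (E∉ u Eu) (true≢false (inBall-mono G x j≤m u∈))

    inBall-star-below : ∀ i → i ≤ m → inBall G x i ≗ inBall G⁺ x i
    inBall-star-below = inBall-cong G G⁺ x m unchanged
      where
      unchanged : ∀ j u v → j < m → inBall G x j u ≡ true → adj G u v ≡ adj G⁺ u v
      unchanged j u v j<m u∈ =
        sym (trans (cong (adj G u v ∨_) (starEdge-away v u≢centre (E-outside j (<⇒≤ j<m) u∈)))
                   (∨-identityʳ _))
        where
        u≢centre : u ≢ centre
        u≢centre refl = true≢false u∈ (centre∉ j j<m)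

    inBall-star-next : ∀ v → inBall G⁺ x (suc m) v ≡ inBall G x (suc m) v ∨ E v
    inBall-star-next v = ≡-by-truth new⇒old old⇒new
      where
      new⇒old : inBall G⁺ x (suc m) v ≡ true → inBall G x (suc m) v ∨ E v ≡ true
      new⇒old h with inBall-suc⁻ G⁺ x m h
      ... | inj₁ v∈ = ∨-true⁺ˡ (E v) (inBall-suc G x m (trans (inBall-star-below m ≤-refl v) v∈))
      ... | inj₂ (u , u∈⁺ , uv) with u∈ ← trans (inBall-star-below m ≤-refl u) u∈⁺ | ∨-true⁻ uv
      ... | inj₁ uv′ = ∨-true⁺ˡ (E v) (inBall-step G x m u∈ uv′)
      ... | inj₂ s with starEdge-inv u v s
      ... | inj₁ (_ , Ev) = ∨-true⁺ʳ _ Ev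
      ... | inj₂ (_ , Eu) = contradiction (E-outside m ≤-refl u∈) (true≢false Eu)
      old⇒new : inBall G x (suc m) v ∨ E v ≡ true → inBall G⁺ x (suc m) v ≡ true
      old⇒new h with ∨-true⁻ h
      ... | inj₁ v∈ = inBall-⊆ᴱ G⊆G⁺ x (suc m) v v∈
      ... | inj₂ Ev = inBall-step G⁺ x m (trans (sym (inBall-star-below m ≤-refl centre)) centre∈)
                                         (starEdge-centre Ev)

flatten-last-layer : (m : ℕ) (G : Graph n) (c : Coloring G k) (x : Fin n) →
  IsLayered G c x (suc (suc m)) →
  Σ (Graph n) λ H → Σ (Coloring H k) λ d →
    IsLayered H d x (suc (suc m)) × G ⊆ᴱ H × col c ≗ col d ×
    numColors H d x (suc (suc m)) ≡ 1 × (∀ i → i ≤ m → inBall G x i ≗ inBall H x i)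
flatten-last-layer {n = n} m G c x ((diam , _) , (ecc , z , z∉))
  with y , y∈ , y∉ , _ ← layer-predecessor G x (suc m) (ecc z) z∉
  with u , u∈ , u∉ , _ ← layer-predecessor G x m y∈ (y∉ m ≤-refl)
  with w , w-last , pivot ← pivot-colour (λ v → not (inBall G x (suc m) v)) (col c) (col c u) z (cong not z∉) =
  G⁺ , coloring⁺ c E-avoids , ((diam⁺ , x , w , w∉⁺) , (diam⁺ x , w , w∉⁺)) , G⊆G⁺ , (λ _ → refl) ,
  trans (cong ∣_∣ (colorsOn-monochromatic w w∈last⁺ last⁺-mono)) (∣⁅x⁆∣≡1 (col c w)) ,
  inBall-star-below x m u∈ u∉ E∉
  where
  E : Fin n → Bool
  E v = not (inBall G x (suc m) v) ∧ not ⌊ col c v ≟ col c w ⌋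

  E-u : E u ≡ false
  E-u = cong (λ b → not b ∧ not ⌊ col c u ≟ col c w ⌋) (inBall-suc G x m u∈)

  open Star G u E E-u

  E-avoids : ∀ v → E v ≡ true → col c u ≢ col c v
  E-avoids v Ev cu≡cv = pivot v (∧-conicalˡ _ _ Ev) (≟-false (not-true (∧-conicalʳ _ _ Ev))) (sym cu≡cv)

  E∉ : ∀ v → E v ≡ true → inBall G x m v ≡ false
  E∉ v Ev = ∨-conicalˡ _ _ (not-true (∧-conicalˡ _ _ Ev))

  diam⁺ : ∀ a b → inBall G⁺ a (suc (suc m)) b ≡ true
  diam⁺ a b = inBall-⊆ᴱ G⊆G⁺ a (suc (suc m)) b (diam a b)

  w∉⁺ : inBall G⁺ x (suc m) w ≡ false
  w∉⁺ = trans (inBall-star-next x m u∈ u∉ E∉ w) (cong₂ _∨_ (not-true w-last) E-w)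
    where
    E-w : E w ≡ false
    E-w = trans (cong (λ b → not (inBall G x (suc m) w) ∧ not b) (≟-refl (col c w))) (∧-zeroʳ _)

  w∈last⁺ : inLayer G⁺ x (suc (suc m)) w ≡ true
  w∈last⁺ = cong₂ (λ a b → a ∧ not b) (diam⁺ x w) w∉⁺

  last⁺-mono : ∀ v → inLayer G⁺ x (suc (suc m)) v ≡ true → col c v ≡ col c w
  last⁺-mono v v-last = ≟-true (not-false (trans (cong (λ b → not b ∧ _) (sym v∉)) E-v))
    where
    old∨E : inBall G x (suc m) v ∨ E v ≡ false
    old∨E = trans (sym (inBall-star-next x m u∈ u∉ E∉ v)) (not-true (∧-conicalʳ _ _ v-last))
    v∉ : inBall G x (suc m) v ≡ false
    v∉ = ∨-conicalˡ _ _ old∨E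
    E-v : E v ≡ false
    E-v = ∨-conicalʳ _ _ old∨E

lemma2p2 : (k n D δ : ℕ) → 3 ≤ k → 2 ≤ D →
  (G' : Graph n) (c' : Coloring G' k) (x : Fin n) →
  IsLayered G' c' x D → MinDegreeAtLeast G' δ →
  Σ (Graph n) (λ G → Σ (Coloring G k) (λ c →
    IsLayered G c x D × MinDegreeAtLeast G δ ×
    numColors G c x 0 ≡ 1 × numColors G c x D ≡ 1 ×
    ((i : ℕ) → i ≤ D ∸ 2 →
      (numColors G' c' x i ≡ numColors G c x i) ×
      ((v : Fin n) → inLayer G' x i v ≡ inLayer G x i v))))
lemma2p2 k n D δ _ (s≤s (s≤s {n = m} _)) G' c' x layered' minDegree' =
  let G , c , layered , G'⊆G , same-col , last-colours , same-balls = flatten-last-layer m G' c' x layered'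
      same-layer = λ i i≤m → inLayer-cong G' G x m same-balls i i≤m
  in G , c , layered , minDegree-⊆ᴱ {G = G'} {G} G'⊆G minDegree' , numColors-root G c x , last-colours ,
     λ i i≤m → numColors-cong G' G c' c x i (same-layer i i≤m) same-col , same-layer i i≤m
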